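{- Consider an instance of Nemesis with a simplified simple graph $G=(V,E)$, a set of exits, and a starting vertex $s$, where $G$ is either a tree or has maximum degree at most $3$. Then the fugitive has a winning strategy from $s$ if and only if $s$ or one of its neighbors in $G$ is the root of a binary escape tree of $G$.
   Context: Nemesis is a two-player game. An instance consists of a finite graph $G=(V,E)$, a set of vertices called exits (other vertices are regular), and a starting vertex $s$ for the first player, the fugitive. In each round the fugitive first moves from his current vertex to an adjacent vertex along an edge still present; then the second player, the Nemesis, permanently removes exactly one edge chosen anywhere in the current graph. The fugitive wins if he reaches an exit; the Nemesis wins if the fugitive ends up in a connected component of the current graph containing no exit. Graph simplification of an instance: (1) duplicate exits so that every exit has degree $1$ (each edge from a regular vertex to an exit is redirected to its own private copy of that exit); (2) iteratively delete every regular vertex other than $s$ having degree $1$ or $2$; (3) discard all connected components not containing $s$. A graph is called simplified if it is the output of this procedure; equivalently it is connected, every exit has degree $1$, and every regular vertex other than $s$ has degree at least $3$. A binary escape tree of $G$ is a rooted full binary tree (every internal node has exactly two children) whose vertices and edges belong to $G$ and all of whose leaves are exits. -}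

module Defs where

open import Data.Bool using (Bool; true; false; T; _∧_; _∨_; if_then_else_; not)
open import Data.Nat using (ℕ; zero; suc; _+_; _≤_)
open import Data.Fin using (Fin; _≟_)
open import Data.List using (List; []; _∷_; _++_; take; length; map; allFin)
open import Data.Nat.ListAction using (sum)
open import Data.List.Relation.Unary.Unique.Propositional using (Unique)
open import Data.Product using (Σ; _×_; _,_)
open import Data.Empty using (⊥)
open import Relation.Nullary using (¬_)
open import Relation.Nullary.Decidable using (⌊_⌋)
open import Relation.Binary.PropositionalEquality using (_≡_)

Edges : ℕ → Set
Edges n = Fin n → Fin n → Bool

SimpleGraph : {n : ℕ} → Edges n → Set
SimpleGraph {n} E = ((u v : Fin n) → E u v ≡ E v u) × ((v : Fin n) → ¬ T (E v v))

degree : {n : ℕ} → Edges n → Fin n → ℕ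
degree {n} E v = sum (map (λ w → if E v w then 1 else 0) (allFin n))

removeEdge : {n : ℕ} → Fin n → Fin n → Edges n → Edges n
removeEdge a b E x y =
  if (⌊ x ≟ a ⌋ ∧ ⌊ y ≟ b ⌋) ∨ (⌊ x ≟ b ⌋ ∧ ⌊ y ≟ a ⌋) then false else E x y

data Reach {n : ℕ} (E : Edges n) : Fin n → Fin n → Set where
  here : ∀ {v} → Reach E v v
  step : ∀ {u w v} → T (E u w) → Reach E w v → Reach E u v

Connected : {n : ℕ} → Edges n → Set
Connected {n} E = (u v : Fin n) → Reach E u v

data Chain {n : ℕ} (E : Edges n) : List (Fin n) → Set where
  nil  : Chain E []
  one  : ∀ {v} → Chain E (v ∷ [])
  cons : ∀ {u w vs} → T (E u w) → Chain E (w ∷ vs) → Chain E (u ∷ w ∷ vs)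

-- A cycle: at least 3 distinct vertices v1 … vk, consecutive ones adjacent,
-- and vk adjacent to v1.
Cycle : {n : ℕ} → Edges n → Set
Cycle {n} E = Σ (List (Fin n)) λ cs → Unique cs × (3 ≤ length cs) × Chain E (cs ++ take 1 cs)

IsTree : {n : ℕ} → Edges n → Set
IsTree E = Connected E × ¬ Cycle E

MaxDegreeAtMost3 : {n : ℕ} → Edges n → Set
MaxDegreeAtMost3 {n} E = (v : Fin n) → degree E v ≤ 3

Simplified : {n : ℕ} → Edges n → (Fin n → Bool) → Fin n → Set
Simplified {n} E X s =
  Connected E
  × ((v : Fin n) → T (X v) → degree E v ≡ 1)
  × ((v : Fin n) → ¬ T (X v) → ¬ (v ≡ s) → 3 ≤ degree E v)

-- Since every round removes an edge the game is finite, so this inductive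
-- definition captures exactly the positions from which he can force
-- reaching an exit.
data FugitiveWins {n : ℕ} (X : Fin n → Bool) : Edges n → Fin n → Set where
  atExit : ∀ {E v} → T (X v) → FugitiveWins X E v
  move   : ∀ {E v} (w : Fin n) → T (E v w) →
           ((a b : Fin n) → T (E a b) → FugitiveWins X (removeEdge a b E) w) →
           FugitiveWins X E v

data BTree (n : ℕ) : Set where
  leaf : Fin n → BTree n
  node : Fin n → BTree n → BTree n → BTree n

root : {n : ℕ} → BTree n → Fin n
root (leaf v) = v
root (node v _ _) = v

vertices : {n : ℕ} → BTree n → List (Fin n)
vertices (leaf v) = v ∷ []
vertices (node v l r) = v ∷ vertices l ++ vertices r

data EdgesLeavesOK {n : ℕ} (E : Edges n) (X : Fin n → Bool) : BTree n → Set where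
  leafOK : ∀ {v} → T (X v) → EdgesLeavesOK E X (leaf v)
  nodeOK : ∀ {v l r} → T (E v (root l)) → T (E v (root r)) →
           EdgesLeavesOK E X l → EdgesLeavesOK E X r → EdgesLeavesOK E X (node v l r)

BinaryEscapeTree : {n : ℕ} → Edges n → (Fin n → Bool) → BTree n → Set
BinaryEscapeTree E X t = Unique (vertices t) × EdgesLeavesOK E X t

{-# OPTIONS --safe #-}
-- A binary escape tree rooted at the fugitive's vertex or at a neighbour of it is a winning
-- strategy: below the current node the two subtrees are disjoint, so the edge removed by the
-- Nemesis spares one of them together with the edge leading into it, and the fugitive steps
-- into that one.
--
-- Conversely, induct on the winning strategy. Let the fugitive move from v to w. Had the
-- Nemesis cut vw, the fugitive would still win, so there is an escape tree t₁ at or next to w;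
-- if w lies in t₁, the subtree of t₁ at w does. Otherwise, had the Nemesis cut the edge from w
-- to the root of t₁, there would be an escape tree t₂ next to w with a different root, and w
-- with subtrees t₁ and t₂ is an escape tree next to v, provided t₁ and t₂ are disjoint. This is
-- the only place where the shape of G matters. In an acyclic graph a common vertex would close
-- a cycle through w. If degrees are at most 3 and exits have degree 1, then every vertex of an
-- escape tree hanging from w other than its root has all its neighbours inside the tree; walking
-- in t₂ from its root to a common vertex then shows that one root lies in the other tree, which
-- therefore contains w.
module Submission where

open import Defs
open import Level using (Level)
open import Function using (_∘_)
open import Data.Bool using (Bool; true; false; T; _∧_; _∨_; not; if_then_else_)
open import Data.Bool.Properties using (∧-zeroʳ)
open import Data.Empty using (⊥; ⊥-elim)
open import Data.Unit using (tt)
open import Data.Fin using (Fin; _≟_)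
open import Data.List using (List; []; _∷_; _++_; length; map)
open import Data.List.Membership.Propositional using (_∈_; _∉_)
open import Data.List.Membership.Propositional.Properties
  using (∈-++⁺ˡ; ∈-++⁺ʳ; ∈-++⁻; ∈-allFin)
open import Data.List.Relation.Unary.Any using (here; there; any?)
open import Data.List.Relation.Unary.All as All using (All; []; _∷_)
open import Data.List.Relation.Unary.All.Properties using (¬Any⇒All¬; All¬⇒¬Any; ++⁻ˡ; ++⁻ʳ)
open import Data.List.Relation.Unary.AllPairs using ([]; _∷_)
open import Data.List.Relation.Unary.Unique.Propositional using (Unique)
open import Data.List.Relation.Unary.Unique.Propositional.Properties using (++⁺)
open import Data.List.Relation.Binary.Disjoint.Propositional using (Disjoint)
open import Data.List.Relation.Binary.Subset.Propositional using (_⊆_)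
open import Data.List.Relation.Binary.Subset.Propositional.Properties using (⊆-refl; ∷⁺ʳ)
open import Data.Nat using (ℕ; suc; _≤_; z≤n; s≤s)
open import Data.Nat.ListAction using (sum)
open import Data.Nat.Properties using (≤-trans; ≤-reflexive; +-mono-≤; +-suc; n≮n)
open import Data.Product using (Σ; _×_; _,_)
open import Data.Sum using (_⊎_; inj₁; inj₂; [_,_])
open import Relation.Binary.Core using (Rel)
open import Relation.Binary.Definitions using (Symmetric; DecidableEquality)
open import Relation.Nullary using (¬_; Dec; yes; no)
open import Relation.Nullary.Decidable using (⌊_⌋)
open import Relation.Binary.PropositionalEquality using (_≡_; _≢_; refl; sym; subst; ≢-sym)
open import Function.Bundles using (_⇔_; mk⇔)

private
  variable
    ℓ : Level
    A : Set ℓ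
    n : ℕ
    E E′ E₀ : Edges n
    X : Fin n → Bool
    a b c u v w x y z : Fin n
    xs ys : List A
    t l r : BTree n

∉⇒≢ : x ∉ xs → y ∈ xs → x ≢ y
∉⇒≢ x∉xs y∈xs refl = x∉xs y∈xs

_∈?_ : (x : Fin n) (xs : List (Fin n)) → Dec (x ∈ xs)
x ∈? xs = any? (x ≟_) xs

Unique-++⁻ : ∀ (xs : List A) → Unique (xs ++ ys) → Unique xs × Unique ys × Disjoint xs ys
Unique-++⁻ [] u = [] , u , λ ()
Unique-++⁻ (x ∷ xs) (x∉ ∷ u) with Unique-++⁻ xs u
... | uxs , uys , xs#ys = ++⁻ˡ xs x∉ ∷ uxs , uys , λ
  { (here refl , y∈ys) → All.lookup (++⁻ʳ xs x∉) y∈ys refl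
  ; (there y∈xs , y∈ys) → xs#ys (y∈xs , y∈ys) }

-- degree E v is definitionally countTrue (E v) (allFin n).
countTrue : (A → Bool) → List A → ℕ
countTrue f xs = sum (map (λ x → if f x then 1 else 0) xs)

indicator-mono : ∀ {p q} → (T p → T q) → (if p then 1 else 0) ≤ (if q then 1 else 0)
indicator-mono {false}         _   = z≤n
indicator-mono {true} {true}   _   = s≤s z≤n
indicator-mono {true} {false}  p⇒q = ⊥-elim (p⇒q tt)

countTrue-mono : ∀ {f g : A → Bool} → (∀ x → T (g x) → T (f x)) →
                 ∀ xs → countTrue g xs ≤ countTrue f xs
countTrue-mono g⇒f []       = z≤n
countTrue-mono g⇒f (x ∷ xs) = +-mono-≤ (indicator-mono (g⇒f x)) (countTrue-mono g⇒f xs)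

module _ (eq? : DecidableEquality A) where

  _∖_ : (A → Bool) → A → A → Bool
  (f ∖ x) y = f y ∧ not ⌊ eq? y x ⌋

  ∖-⊆ : ∀ f (x y : A) → T ((f ∖ x) y) → T (f y)
  ∖-⊆ f x y h with f y
  ... | true = tt

  ∖-removes : ∀ f (x : A) → ¬ T ((f ∖ x) x)
  ∖-removes f x h with eq? x x
  ... | yes _  = subst T (∧-zeroʳ (f x)) h
  ... | no x≢x = x≢x refl

  ∖-keeps : ∀ f {x y : A} → T (f y) → x ≢ y → T ((f ∖ x) y)
  ∖-keeps f {x} {y} fy x≢y with eq? y x
  ... | yes y≡x = ⊥-elim (x≢y (sym y≡x))
  ... | no _ with f y
  ...   | true = tt

  countTrue-∖ : ∀ f {x : A} {xs} → x ∈ xs → T (f x) →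
                suc (countTrue (f ∖ x) xs) ≤ countTrue f xs
  countTrue-∖ f {x} {x ∷ xs} (here refl) fx =
    +-mono-≤ (≤-trans (s≤s (indicator-mono (⊥-elim ∘ ∖-removes f x)))
                      (indicator-mono {true} (λ _ → fx)))
             (countTrue-mono (∖-⊆ f x) xs)
  countTrue-∖ f {x} {y ∷ xs} (there x∈xs) fx =
    ≤-trans (≤-reflexive (sym (+-suc _ _)))
            (+-mono-≤ (indicator-mono (∖-⊆ f x y)) (countTrue-∖ f x∈xs fx))

  unique≤countTrue : ∀ {f} {xs ys : List A} → Unique xs → All (T ∘ f) xs → xs ⊆ ys →
                     length xs ≤ countTrue f ys
  unique≤countTrue [] [] _ = z≤n
  unique≤countTrue {f} {x ∷ xs} (x∉xs ∷ u) (fx ∷ fxs) xs⊆ys =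
    ≤-trans (s≤s (unique≤countTrue u fxs∖x (xs⊆ys ∘ there)))
            (countTrue-∖ f (xs⊆ys (here refl)) fx)
    where
    fxs∖x : All (T ∘ (f ∖ x)) xs
    fxs∖x = All.zipWith (λ (fy , x≢y) → ∖-keeps f fy x≢y) (fxs , x∉xs)

distinct-neighbours≤degree : ∀ (E : Edges n) v → Unique xs → All (T ∘ E v) xs →
                             length xs ≤ degree E v
distinct-neighbours≤degree E v u adj = unique≤countTrue _≟_ u adj (λ {x} _ → ∈-allFin x)

Adjacent : Edges n → Rel (Fin n) _
Adjacent E x y = T (E x y)

_⊆ᴱ_ : Edges n → Edges n → Set
E ⊆ᴱ E′ = ∀ {x y} → T (E x y) → T (E′ x y)

removeEdge-⊆ : ∀ a b (E : Edges n) → removeEdge a b E ⊆ᴱ E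
removeEdge-⊆ a b E {x} {y} h
  with (⌊ x ≟ a ⌋ ∧ ⌊ y ≟ b ⌋) ∨ (⌊ x ≟ b ⌋ ∧ ⌊ y ≟ a ⌋)
... | false = h

removeEdge-removes : ∀ a b (E : Edges n) → ¬ T (removeEdge a b E a b)
removeEdge-removes a b E h with a ≟ a | b ≟ b
... | no a≢a | _      = a≢a refl
... | yes _  | no b≢b = b≢b refl

≢-∧-false : a ≢ x ⊎ b ≢ y → (⌊ x ≟ a ⌋ ∧ ⌊ y ≟ b ⌋) ≡ false
≢-∧-false {a = a} {x = x} (inj₁ a≢x) with x ≟ a
... | yes x≡a = ⊥-elim (a≢x (sym x≡a))
... | no _    = refl
≢-∧-false {a = a} {x = x} {b = b} {y = y} (inj₂ b≢y) with y ≟ b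
... | yes y≡b = ⊥-elim (b≢y (sym y≡b))
... | no _    = ∧-zeroʳ ⌊ x ≟ a ⌋

removeEdge-keeps : ∀ (E : Edges n) → a ≢ x ⊎ b ≢ y → b ≢ x ⊎ a ≢ y →
                   T (E x y) → T (removeEdge a b E x y)
removeEdge-keeps E p q h rewrite ≢-∧-false p | ≢-∧-false q = h

removeEdge-keeps-within : ∀ (E : Edges n) {S} → a ∉ S ⊎ b ∉ S → x ∈ S → y ∈ S →
                          T (E x y) → T (removeEdge a b E x y)
removeEdge-keeps-within E (inj₁ a∉S) x∈S y∈S =
  removeEdge-keeps E (inj₁ (∉⇒≢ a∉S x∈S)) (inj₂ (∉⇒≢ a∉S y∈S))
removeEdge-keeps-within E (inj₂ b∉S) x∈S y∈S =
  removeEdge-keeps E (inj₂ (∉⇒≢ b∉S y∈S)) (inj₁ (∉⇒≢ b∉S x∈S))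

removeEdge-keeps-into : ∀ (E : Edges n) {S} → a ∉ S → b ∉ S → y ∈ S →
                        T (E x y) → T (removeEdge a b E x y)
removeEdge-keeps-into E a∉S b∉S y∈S =
  removeEdge-keeps E (inj₂ (∉⇒≢ b∉S y∈S)) (inj₂ (∉⇒≢ a∉S y∈S))

root∈vertices : (t : BTree n) → root t ∈ vertices t
root∈vertices (leaf _)     = here refl
root∈vertices (node _ _ _) = here refl

data IsEscapeTree (E : Edges n) (X : Fin n → Bool) : BTree n → Set

record HangsFrom (E : Edges n) (X : Fin n → Bool) (v : Fin n) (t : BTree n) : Set where
  inductive
  constructor hang
  field
    edge  : T (E v (root t))
    fresh : v ∉ vertices t
    tree  : IsEscapeTree E X t

open HangsFrom

data IsEscapeTree E X where
  leaf : T (X v) → IsEscapeTree E X (leaf v)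
  node : HangsFrom E X v l → HangsFrom E X v r → Disjoint (vertices l) (vertices r) →
         IsEscapeTree E X (node v l r)

isEscapeTree⇒binaryEscapeTree : IsEscapeTree E X t → BinaryEscapeTree E X t
isEscapeTree⇒binaryEscapeTree (leaf x) = [] ∷ [] , leafOK x
isEscapeTree⇒binaryEscapeTree {t = node v l r} (node (hang vl v∉l tl) (hang vr v∉r tr) l#r)
  with isEscapeTree⇒binaryEscapeTree tl | isEscapeTree⇒binaryEscapeTree tr
... | ul , okl | ur , okr =
  ¬Any⇒All¬ _ ([ v∉l , v∉r ] ∘ ∈-++⁻ (vertices l)) ∷ ++⁺ ul ur l#r ,
  nodeOK vl vr okl okr

binaryEscapeTree⇒isEscapeTree : BinaryEscapeTree E X t → IsEscapeTree E X t
binaryEscapeTree⇒isEscapeTree (_ , leafOK x) = leaf x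
binaryEscapeTree⇒isEscapeTree {t = node v l r} (v∉ ∷ u , nodeOK vl vr okl okr)
  with Unique-++⁻ (vertices l) u
... | ul , ur , l#r =
  node (hang vl (All¬⇒¬Any (++⁻ˡ _ v∉)) (binaryEscapeTree⇒isEscapeTree (ul , okl)))
       (hang vr (All¬⇒¬Any (++⁻ʳ _ v∉)) (binaryEscapeTree⇒isEscapeTree (ur , okr)))
       l#r

subtree-at : IsEscapeTree E X t → x ∈ vertices t →
             Σ (BTree _) λ s → IsEscapeTree E X s × root s ≡ x
subtree-at {t = leaf v} tr (here refl) = leaf v , tr , refl
subtree-at {t = node v l r} tr (here refl) = node v l r , tr , refl
subtree-at {t = node v l r} (node (hang _ _ tl) (hang _ _ tr) _) (there x∈)
  with ∈-++⁻ (vertices l) x∈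
... | inj₁ x∈l = subtree-at tl x∈l
... | inj₂ x∈r = subtree-at tr x∈r

isEscapeTree-mono : (∀ {x y} → x ∈ vertices t → y ∈ vertices t → T (E x y) → T (E′ x y)) →
                    IsEscapeTree E X t → IsEscapeTree E′ X t
hangsFrom-mono : (∀ {x y} → x ∈ v ∷ vertices t → y ∈ vertices t → T (E x y) → T (E′ x y)) →
                 HangsFrom E X v t → HangsFrom E′ X v t

isEscapeTree-mono keep (leaf x) = leaf x
isEscapeTree-mono {t = node v l r} keep (node hl hr l#r) =
  node (hangsFrom-mono (λ x∈ y∈ → keep (inside-l x∈) (there (∈-++⁺ˡ y∈))) hl)
       (hangsFrom-mono (λ x∈ y∈ → keep (inside-r x∈) (there (∈-++⁺ʳ (vertices l) y∈))) hr)
       l#r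
  where
  inside-l : v ∷ vertices l ⊆ vertices (node v l r)
  inside-l = ∷⁺ʳ v ∈-++⁺ˡ
  inside-r : v ∷ vertices r ⊆ vertices (node v l r)
  inside-r = ∷⁺ʳ v (∈-++⁺ʳ (vertices l))

hangsFrom-mono {t = t} keep (hang e v∉t tr) =
  hang (keep (here refl) (root∈vertices t) e) v∉t (isEscapeTree-mono (keep ∘ there) tr)

sibling-avoids : HangsFrom E X v l → Disjoint (vertices l) (vertices r) →
                 c ∈ vertices l → c ∉ v ∷ vertices r
sibling-avoids hl l#r c∈l (here refl)  = fresh hl c∈l
sibling-avoids hl l#r c∈l (there c∈r) = l#r (c∈l , c∈r)

-- An endpoint of the removed edge lying in l is outside v ∷ vertices r; if neither endpoint lies
-- in l, every edge into l survives, even when v is an endpoint.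
surviving-child : HangsFrom E X v l → HangsFrom E X v r → Disjoint (vertices l) (vertices r) →
                  ∀ a b → HangsFrom (removeEdge a b E) X v l ⊎ HangsFrom (removeEdge a b E) X v r
surviving-child {E = E} {l = l} hl hr l#r a b with a ∈? vertices l | b ∈? vertices l
... | yes a∈l | _ = inj₂ (hangsFrom-mono (λ x∈ y∈ →
  removeEdge-keeps-within E (inj₁ (sibling-avoids hl l#r a∈l)) x∈ (there y∈)) hr)
... | _ | yes b∈l = inj₂ (hangsFrom-mono (λ x∈ y∈ →
  removeEdge-keeps-within E (inj₂ (sibling-avoids hl l#r b∈l)) x∈ (there y∈)) hr)
... | no a∉l | no b∉l = inj₁ (hangsFrom-mono (λ _ → removeEdge-keeps-into E a∉l b∉l) hl)

escape-from-root : IsEscapeTree E X t → ∀ a b → FugitiveWins X (removeEdge a b E) (root t)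
escape-via : T (E v (root t)) → IsEscapeTree E X t → FugitiveWins X E v

escape-from-root (leaf x) a b = atExit x
escape-from-root (node hl hr l#r) a b with surviving-child hl hr l#r a b
... | inj₁ (hang e _ tl) = escape-via e tl
... | inj₂ (hang e _ tr) = escape-via e tr

escape-via e tr = move _ e (λ a b _ → escape-from-root tr a b)

escape-near : IsEscapeTree E X t → root t ≡ v ⊎ T (E v (root t)) → FugitiveWins X E v
escape-near (leaf x)                 (inj₁ refl) = atExit x
escape-near (node (hang e _ tl) _ _) (inj₁ refl) = escape-via e tl
escape-near tr                       (inj₂ e)    = escape-via e tr

data Walk (E : Edges n) : Fin n → Fin n → Set where
  []  : ∀ {a} → Walk E a a
  _∷_ : ∀ {a b c} → T (E a b) → Walk E b c → Walk E a c

infixr 5 _∷_ _++ʷ_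

tailVertices : {E : Edges n} {a c : Fin n} → Walk E a c → List (Fin n)
tailVertices []                = []
tailVertices (_∷_ {b = b} _ p) = b ∷ tailVertices p

walkVertices : {E : Edges n} {a c : Fin n} → Walk E a c → List (Fin n)
walkVertices {a = a} p = a ∷ tailVertices p

_++ʷ_ : Walk E a b → Walk E b c → Walk E a c
[]      ++ʷ q = q
(e ∷ p) ++ʷ q = e ∷ (p ++ʷ q)

++ʷ-vertices : (p : Walk E a b) (q : Walk E b c) →
               walkVertices (p ++ʷ q) ⊆ walkVertices p ++ walkVertices q
++ʷ-vertices []      q = there
++ʷ-vertices (e ∷ p) q = ∷⁺ʳ _ (++ʷ-vertices p q)

reverseʷ : Symmetric (Adjacent E) → Walk E a c → Walk E c a
reverseʷ E-sym []      = []
reverseʷ E-sym (e ∷ p) = reverseʷ E-sym p ++ʷ E-sym e ∷ []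

reverseʷ-vertices : (E-sym : Symmetric (Adjacent E)) (p : Walk E a c) →
                    walkVertices (reverseʷ E-sym p) ⊆ walkVertices p
reverseʷ-vertices E-sym []      = ⊆-refl
reverseʷ-vertices E-sym (e ∷ p) x∈
  with ∈-++⁻ _ (++ʷ-vertices (reverseʷ E-sym p) (E-sym e ∷ []) x∈)
... | inj₁ x∈p                = there (reverseʷ-vertices E-sym p x∈p)
... | inj₂ (here refl)        = there (here refl)
... | inj₂ (there (here refl)) = here refl

dropUntil : (p : Walk E a c) → x ∈ walkVertices p → Walk E x c
dropUntil p       (here refl) = p
dropUntil (_ ∷ p) (there x∈p) = dropUntil p x∈p

dropUntil-vertices : (p : Walk E a c) (x∈p : x ∈ walkVertices p) →
                     walkVertices (dropUntil p x∈p) ⊆ walkVertices p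
dropUntil-vertices p       (here refl) = ⊆-refl
dropUntil-vertices (_ ∷ p) (there x∈p) = there ∘ dropUntil-vertices p x∈p

dropUntil-unique : (p : Walk E a c) (x∈p : x ∈ walkVertices p) →
                   Unique (walkVertices p) → Unique (walkVertices (dropUntil p x∈p))
dropUntil-unique p       (here refl) u       = u
dropUntil-unique (_ ∷ p) (there x∈p) (_ ∷ u) = dropUntil-unique p x∈p u

erase-loops : (p : Walk E a c) →
              Σ (Walk E a c) λ q → Unique (walkVertices q) × walkVertices q ⊆ walkVertices p
erase-loops []              = [] , [] ∷ [] , ⊆-refl
erase-loops {a = a} (e ∷ p) with erase-loops p
... | q , q-unique , q⊆p with a ∈? walkVertices q
...   | yes a∈q =
  dropUntil q a∈q , dropUntil-unique q a∈q q-unique , there ∘ q⊆p ∘ dropUntil-vertices q a∈q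
...   | no a∉q  = e ∷ q , ¬Any⇒All¬ _ a∉q ∷ q-unique , ∷⁺ʳ a q⊆p

walk-chain : (p : Walk E a c) → T (E c w) → Chain E (walkVertices p ++ w ∷ [])
walk-chain []      e = cons e one
walk-chain (e ∷ p) f = cons e (walk-chain p f)

path-cycle : (p : Walk E u v) → Unique (walkVertices p) → w ∉ walkVertices p → u ≢ v →
             T (E w u) → T (E v w) → Cycle E
path-cycle [] _ _ u≢v _ _ = ⊥-elim (u≢v refl)
path-cycle {w = w} p@(_ ∷ _) u w∉p _ wu vw =
  w ∷ walkVertices p , ¬Any⇒All¬ _ w∉p ∷ u , s≤s (s≤s (s≤s z≤n)) ,
  cons wu (walk-chain p vw)

walk-escapes : {S : List (Fin n)} {r : Fin n} →
               (∀ {x z} → x ∈ S → x ≢ r → T (E z x) → z ∈ S) →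
               (p : Walk E a c) → c ∈ S → a ∈ S ⊎ r ∈ walkVertices p
walk-escapes closed []            c∈S = inj₁ c∈S
walk-escapes {r = r} closed (_∷_ {b = b} e p) c∈S with walk-escapes closed p c∈S
... | inj₂ r∈p = inj₂ (there r∈p)
... | inj₁ b∈S with b ≟ r
...   | yes refl = inj₂ (there (here refl))
...   | no b≢r   = inj₁ (closed b∈S b≢r e)

walk-from-root : IsEscapeTree E X t → x ∈ vertices t →
                 Σ (Walk E (root t) x) λ p → walkVertices p ⊆ vertices t
walk-from-root {t = leaf v}     _ (here refl) = [] , ⊆-refl
walk-from-root {t = node v l r} _ (here refl) = [] , ∷⁺ʳ v (λ ())
walk-from-root {t = node v l r} (node (hang vl _ tl) (hang vr _ tr) _) (there x∈)
  with ∈-++⁻ (vertices l) x∈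
... | inj₁ x∈l = let p , p⊆l = walk-from-root tl x∈l in
  vl ∷ p , ∷⁺ʳ v (∈-++⁺ˡ ∘ p⊆l)
... | inj₂ x∈r = let p , p⊆r = walk-from-root tr x∈r in
  vr ∷ p , ∷⁺ʳ v (∈-++⁺ʳ (vertices l) ∘ p⊆r)

HangingTreesDisjoint : Edges n → (Fin n → Bool) → Set
HangingTreesDisjoint E X = ∀ {w t₁ t₂} → HangsFrom E X w t₁ → HangsFrom E X w t₂ →
                           root t₁ ≢ root t₂ → Disjoint (vertices t₁) (vertices t₂)

acyclic⇒hangingTreesDisjoint : Symmetric (Adjacent E) → ¬ Cycle E → HangingTreesDisjoint E X
acyclic⇒hangingTreesDisjoint E-sym acyclic {w} h₁ h₂ r₁≢r₂ (x∈₁ , x∈₂)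
  with walk-from-root (tree h₁) x∈₁ | walk-from-root (tree h₂) x∈₂
... | p₁ , p₁⊆t₁ | p₂ , p₂⊆t₂ with erase-loops (p₁ ++ʷ reverseʷ E-sym p₂)
... | q , q-unique , q⊆ =
  acyclic (path-cycle q q-unique w∉q r₁≢r₂ (edge h₁) (E-sym (edge h₂)))
  where
  w∉q : w ∉ walkVertices q
  w∉q w∈q with ∈-++⁻ (walkVertices p₁) (++ʷ-vertices p₁ (reverseʷ E-sym p₂) (q⊆ w∈q))
  ... | inj₁ w∈p₁ = fresh h₁ (p₁⊆t₁ w∈p₁)
  ... | inj₂ w∈p₂ = fresh h₂ (p₂⊆t₂ (reverseʷ-vertices E-sym p₂ w∈p₂))

module Subcubic {E : Edges n} {X : Fin n → Bool}
                (E-sym : Symmetric (Adjacent E)) (≤3 : MaxDegreeAtMost3 E)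
                (exit-degree : ∀ v → T (X v) → degree E v ≡ 1) where

  exit-neighbour-unique : T (X x) → T (E x a) → T (E x b) → a ≡ b
  exit-neighbour-unique {x = x} {a = a} {b = b} x-exit xa xb with a ≟ b
  ... | yes a≡b = a≡b
  ... | no a≢b  = ⊥-elim (n≮n 1 (subst (2 ≤_) (exit-degree x x-exit) two≤degree))
    where
    two≤degree : 2 ≤ degree E x
    two≤degree = distinct-neighbours≤degree E x ((a≢b ∷ []) ∷ [] ∷ []) (xa ∷ xb ∷ [])

  no-four-neighbours : Unique (a ∷ b ∷ c ∷ u ∷ []) →
                       All (T ∘ E v) (a ∷ b ∷ c ∷ u ∷ []) → ⊥
  no-four-neighbours {v = v} distinct adjacent =
    n≮n 3 (≤-trans (distinct-neighbours≤degree E v distinct adjacent) (≤3 v))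

  root-neighbours : HangsFrom E X w t → T (E (root t) z) → z ≡ w ⊎ z ∈ vertices t
  root-neighbours (hang e _ (leaf x)) e′ = inj₁ (exit-neighbour-unique x e′ (E-sym e))
  root-neighbours {w = w} {t = node v l r} {z = z} (hang e w∉t (node hl hr l#r)) e′
    with z ≟ w | z ∈? vertices (node v l r)
  ... | yes z≡w | _      = inj₁ z≡w
  ... | no _    | yes z∈ = inj₂ z∈
  ... | no z≢w  | no z∉  =
    ⊥-elim (no-four-neighbours distinct (E-sym e ∷ edge hl ∷ edge hr ∷ e′ ∷ []))
    where
    rl∈ : root l ∈ vertices (node v l r)
    rl∈ = there (∈-++⁺ˡ (root∈vertices l))
    rr∈ : root r ∈ vertices (node v l r)
    rr∈ = there (∈-++⁺ʳ (vertices l) (root∈vertices r))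
    rl≢rr : root l ≢ root r
    rl≢rr rl≡rr = l#r (root∈vertices l , subst (_∈ vertices r) (sym rl≡rr) (root∈vertices r))
    distinct : Unique (w ∷ root l ∷ root r ∷ z ∷ [])
    distinct = (∉⇒≢ w∉t rl∈ ∷ ∉⇒≢ w∉t rr∈ ∷ ≢-sym z≢w ∷ [])
             ∷ (rl≢rr ∷ ≢-sym (∉⇒≢ z∉ rl∈) ∷ [])
             ∷ (≢-sym (∉⇒≢ z∉ rr∈) ∷ [])
             ∷ [] ∷ []

  interior-closed : IsEscapeTree E X t → x ∈ vertices t → x ≢ root t →
                    T (E x z) → z ∈ vertices t
  hanging-closed : HangsFrom E X w t → x ∈ vertices t → T (E x z) → z ≡ w ⊎ z ∈ vertices t

  interior-closed {t = leaf _}     _ (here refl) x≢v _ = ⊥-elim (x≢v refl)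
  interior-closed {t = node _ _ _} _ (here refl) x≢v _ = ⊥-elim (x≢v refl)
  interior-closed {t = node v l r} (node hl hr _) (there x∈) _ e with ∈-++⁻ (vertices l) x∈
  ... | inj₁ x∈l = [ (λ { refl → here refl }) , there ∘ ∈-++⁺ˡ ] (hanging-closed hl x∈l e)
  ... | inj₂ x∈r =
    [ (λ { refl → here refl }) , there ∘ ∈-++⁺ʳ (vertices l) ] (hanging-closed hr x∈r e)

  hanging-closed {t = t} {x = x} h x∈t e with x ≟ root t
  ... | yes refl = root-neighbours h e
  ... | no x≢r   = inj₂ (interior-closed (tree h) x∈t x≢r e)

  subcubic⇒hangingTreesDisjoint : HangingTreesDisjoint E X
  subcubic⇒hangingTreesDisjoint h₁ h₂ r₁≢r₂ (x∈₁ , x∈₂)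
    with walk-from-root (tree h₂) x∈₂
  ... | p , p⊆t₂
    with walk-escapes (λ y∈ y≢r e → interior-closed (tree h₁) y∈ y≢r (E-sym e)) p x∈₁
  ... | inj₁ r₂∈t₁ =
    fresh h₁ (interior-closed (tree h₁) r₂∈t₁ (≢-sym r₁≢r₂) (E-sym (edge h₂)))
  ... | inj₂ r₁∈p  =
    fresh h₂ (interior-closed (tree h₂) (p⊆t₂ r₁∈p) r₁≢r₂ (E-sym (edge h₁)))

EscapeTreeNear : Edges n → (Fin n → Bool) → Edges n → Fin n → Set
EscapeTreeNear {n} E₀ X E v =
  Σ (BTree n) λ t → IsEscapeTree E₀ X t × (root t ≡ v ⊎ T (E v (root t)))

locate : {P : Set} (t : BTree n) → root t ≡ w ⊎ P → w ∈ vertices t ⊎ (w ∉ vertices t × P)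
locate t (inj₁ refl) = inj₁ (root∈vertices t)
locate {w = w} t (inj₂ e) with w ∈? vertices t
... | yes w∈t = inj₁ w∈t
... | no w∉t  = inj₂ (w∉t , e)

subtree-near : IsEscapeTree E₀ X t → w ∈ vertices t → T (E v w) → EscapeTreeNear E₀ X E v
subtree-near tr w∈t vw with subtree-at tr w∈t
... | s , s-tree , refl = s , s-tree , inj₂ vw

module _ {E₀ : Edges n} {X : Fin n → Bool} (disjoint : HangingTreesDisjoint E₀ X) where

  escape-after-move : E ⊆ᴱ E₀ → T (E v w) →
                      (∀ a b → T (E a b) → EscapeTreeNear E₀ X (removeEdge a b E) w) →
                      EscapeTreeNear E₀ X E v
  escape-after-move {E = E} {v = v} {w = w} E⊆E₀ vw after with after v w vw
  ... | t₁ , t₁-tree , near₁ with locate t₁ near₁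
  ... | inj₁ w∈t₁ = subtree-near {E = E} t₁-tree w∈t₁ vw
  ... | inj₂ (w∉t₁ , wt₁) with after w (root t₁) (removeEdge-⊆ v w E wt₁)
  ... | t₂ , t₂-tree , near₂ with locate t₂ near₂
  ... | inj₁ w∈t₂ = subtree-near {E = E} t₂-tree w∈t₂ vw
  ... | inj₂ (w∉t₂ , wt₂) =
    node w t₁ t₂ , node h₁ h₂ (disjoint h₁ h₂ r₁≢r₂) , inj₂ vw
    where
    h₁ : HangsFrom E₀ X w t₁
    h₁ = hang (E⊆E₀ (removeEdge-⊆ v w E wt₁)) w∉t₁ t₁-tree
    h₂ : HangsFrom E₀ X w t₂
    h₂ = hang (E⊆E₀ (removeEdge-⊆ w (root t₁) E wt₂)) w∉t₂ t₂-tree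
    r₁≢r₂ : root t₁ ≢ root t₂
    r₁≢r₂ r₁≡r₂ = removeEdge-removes w (root t₁) E
                    (subst (λ u → T (removeEdge w (root t₁) E w u)) (sym r₁≡r₂) wt₂)

  escapeTree-of-win : E ⊆ᴱ E₀ → FugitiveWins X E v → EscapeTreeNear E₀ X E v
  escapeTree-of-win _ (atExit {v = v} x) = leaf v , leaf x , inj₁ refl
  escapeTree-of-win {E = E} E⊆E₀ (move w vw wins) =
    escape-after-move E⊆E₀ vw λ a b ab →
      escapeTree-of-win (E⊆E₀ ∘ removeEdge-⊆ a b E) (wins a b ab)

lemma12 : (n : ℕ) (E : Edges n) (X : Fin n → Bool) (s : Fin n) →
    SimpleGraph E → Simplified E X s → (IsTree E ⊎ MaxDegreeAtMost3 E) →
    FugitiveWins X E s ⇔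
      Σ (BTree n) (λ t → BinaryEscapeTree E X t × (root t ≡ s ⊎ T (E s (root t))))
lemma12 n E X s (E-symmetric , _) (_ , exit-degree , _) tree-or-subcubic =
  mk⇔ (λ win → let t , t-tree , near = escapeTree-of-win disjoint (λ e → e) win
               in t , isEscapeTree⇒binaryEscapeTree t-tree , near)
      (λ (t , t-binary , near) → escape-near (binaryEscapeTree⇒isEscapeTree t-binary) near)
  where
  E-sym : Symmetric (Adjacent E)
  E-sym {x} {y} = subst T (E-symmetric x y)

  disjoint : HangingTreesDisjoint E X
  disjoint = [ (λ (_ , acyclic) → acyclic⇒hangingTreesDisjoint E-sym acyclic)
             , (λ ≤3 → Subcubic.subcubic⇒hangingTreesDisjoint E-sym ≤3 exit-degree)
             ] tree-or-subcubic
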